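{- Let $\Lambda$ be a $k$-graph with $1$-skeleton $E$, set of commuting squares $S$, augmented graph $E^+$ and cancellation relations $C$. Let $\mathcal G(\Lambda)$ be the fundamental groupoid of $\Lambda$ with canonical functor $i\colon\Lambda\to\mathcal G(\Lambda)$, and let $\Delta\colon E^+\to\mathcal P(E^+)/(C\cup S)$ be the canonical diagram of type $E^+$ satisfying $C\cup S$. Then there is a unique isomorphism $T\colon\mathcal G(\Lambda)\to\mathcal P(E^+)/(C\cup S)$ such that $T\circ i|_E=\Delta|_E$, where $i|_E$ is the restriction of $i$ to the vertices and edges of $E$ and $\Delta|_E$ is the restriction of $\Delta$ to the subgraph $E\subseteq E^+$.
   Context: Conventions for a small category $\mathbb C$: objects are identified with identity morphisms; $s(a)$, $r(a)$ denote domain (source) and codomain (range); composition is juxtaposition, $ab=a\circ b$ when $s(a)=r(b)$. A $k$-graph is a countable small category $\Lambda$ with a functor $d\colon\Lambda\to\mathbb N^k$ such that for all $\alpha\in\Lambda$ and $n,l\in\mathbb N^k$ with $d(\alpha)=n+l$ there are unique $\beta,\gamma$ with $d(\beta)=n$, $d(\gamma)=l$, $\alpha=\beta\gamma$. Write $\Lambda^0$ for objects, $\Lambda^n=d^{ -1}(n)$, and $n_1,\dots,n_k$ for the standard basis of $\mathbb N^k$. The fundamental groupoid $\mathcal G(\Lambda)$ is the category of fractions $\Lambda[\Lambda^{ -1}]$ together with the canonical functor $i\colon\Lambda\to\mathcal G(\Lambda)$: it is characterized (up to isomorphism) by $i(a)$ being invertible for all $a\in\Lambda$ and the universal property that every functor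 $F$ from $\Lambda$ to a category in which all $F(a)$ are invertible factors uniquely as $F=F'\circ i$; it is a groupoid with the same objects as $\Lambda$, $i$ being the identity on objects. A graph $E=(E^0,E^1,r,s)$; a diagram of type $E$ in a category is a graph morphism into its underlying graph. $\mathcal P(E)$ is the path category (free category) on $E$, paths $e_1\cdots e_m$ written in composition order ($s(e_i)=r(e_{i+1})$). A relation for $E$ is a pair $(\alpha,\beta)$ of paths with common source and range; a diagram satisfies it if it sends $\alpha,\beta$ to the same morphism. For a set $K$ of relations, $\mathcal P(E)/K$ is the quotient of $\mathcal P(E)$ by the smallest equivalence relation containing $K$ compatible with composition (objects identified with $E^0$), and $\Delta\colon E\hookrightarrow\mathcal P(E)\to\mathcal P(E)/K$ is the canonical diagram of type $E$ satisfying $K$. The $1$-skeleton of $\Lambda$ is the graph $E$ with $E^0=\Lambda^0$, $E^1=\bigcup_{i=1}^k\Lambda^{n_i}$, range and source inherited from $\Lambda$. For composable $e,f\in E^1$ ($s(e)=r(f)$) with $d(e)\ne d(f)$ there are unique edges $g,h$ with $ef=gh$ in $\Lambda$, $d(g)=d(f)$, $d(h)=d(e)$; the relation $(ef,gh)$ is a commuting square, and $S$ is the set of all of them (regarded as relations for $E^+$). The augmented graph $E^+$ has vertex set $E^0$ and edge set $E^1\cup E^{ -1}$, where $E^{ -1}=\{e^{ -1}: e\in E^1\}$ is a set of new edges with $s(e^{ -1})=r(e)$, $r(e^{ -1})=s(e)$; set $(e^{ -1})^{ -1}=e$. The cancellation relations are $C=\{(e^{ -1}e,\,s(e)) : e\in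 E^1\cup E^{ -1}\}$, where $s(e)$ denotes the empty path at $s(e)$. -}

module Defs where

open import Level using (0ℓ)
open import Data.Nat using (ℕ; zero; suc; _+_)
open import Data.Fin using (Fin)
import Data.Fin as Fin
open import Data.Vec using (Vec; tabulate; zipWith)
open import Data.Bool using (if_then_else_)
open import Data.Product using (Σ; Σ-syntax; ∃; ∃!; _×_; _,_; proj₁; proj₂)
open import Data.Sum using (_⊎_; inj₁; inj₂)
open import Function using (Injective)
open import Relation.Nullary using (¬_; does)
open import Relation.Binary using (Rel; IsEquivalence)
open import Relation.Binary.PropositionalEquality
  using (_≡_; refl; sym; trans; cong; subst₂; isEquivalence)

record Category (Obj : Set) : Set₁ where
  infixr 9 _∘_
  infix 4 _≈_
  field
    Hom       : Obj → Obj → Set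
    _≈_       : ∀ {A B} → Rel (Hom A B) 0ℓ
    ≈-equiv   : ∀ {A B} → IsEquivalence (_≈_ {A} {B})
    id        : ∀ {A} → Hom A A
    _∘_       : ∀ {A B C} → Hom B C → Hom A B → Hom A C
    assoc     : ∀ {A B C D} (f : Hom C D) (g : Hom B C) (h : Hom A B) →
                (f ∘ g) ∘ h ≈ f ∘ (g ∘ h)
    identityˡ : ∀ {A B} (f : Hom A B) → id ∘ f ≈ f
    identityʳ : ∀ {A B} (f : Hom A B) → f ∘ id ≈ f
    ∘-resp-≈  : ∀ {A B C} {f f' : Hom B C} {g g' : Hom A B} →
                f ≈ f' → g ≈ g' → f ∘ g ≈ f' ∘ g'

open Category public using () renaming (Hom to Hom[_])

module _ {O : Set} (C : Category O) where
  open Category C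

  IsInvertible : ∀ {A B} → Hom A B → Set
  IsInvertible {A} {B} f = Σ (Hom B A) λ g → (g ∘ f ≈ id) × (f ∘ g ≈ id)

  IsGroupoid : Set
  IsGroupoid = ∀ {A B} (f : Hom A B) → IsInvertible f

  cast : {P : Set} {f g : P → O} (p : ∀ x → f x ≡ g x) {u v : P} →
         Hom (f u) (f v) → Hom (g u) (g v)
  cast p {u} {v} = subst₂ Hom (p u) (p v)

record Functor {O₁ O₂ : Set} (C : Category O₁) (D : Category O₂) : Set where
  private
    module C = Category C
    module D = Category D
  field
    F₀           : O₁ → O₂
    F₁           : ∀ {A B} → C.Hom A B → D.Hom (F₀ A) (F₀ B)
    F-resp-≈     : ∀ {A B} {f g : C.Hom A B} → f C.≈ g → F₁ f D.≈ F₁ g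
    identity     : ∀ {A} → F₁ (C.id {A}) D.≈ D.id
    homomorphism : ∀ {A B E} (f : C.Hom B E) (g : C.Hom A B) →
                   F₁ (f C.∘ g) D.≈ F₁ f D.∘ F₁ g

open Functor public

IdF : {O : Set} (C : Category O) → Functor C C
IdF C = record
  { F₀ = λ x → x ; F₁ = λ f → f ; F-resp-≈ = λ p → p
  ; identity = IsEquivalence.refl (Category.≈-equiv C)
  ; homomorphism = λ f g → IsEquivalence.refl (Category.≈-equiv C) }

_∘F_ : {O₁ O₂ O₃ : Set} {C : Category O₁} {D : Category O₂} {E : Category O₃} →
       Functor D E → Functor C D → Functor C E
_∘F_ {E = E} G F = record
  { F₀ = λ x → F₀ G (F₀ F x)
  ; F₁ = λ f → F₁ G (F₁ F f)
  ; F-resp-≈ = λ p → F-resp-≈ G (F-resp-≈ F p)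
  ; identity = IsEquivalence.trans (Category.≈-equiv E)
                 (F-resp-≈ G (identity F)) (identity G)
  ; homomorphism = λ f g → IsEquivalence.trans (Category.≈-equiv E)
                 (F-resp-≈ G (homomorphism F f g)) (homomorphism G _ _) }

_≡F_ : {O₁ O₂ : Set} {C : Category O₁} {D : Category O₂} →
       Functor C D → Functor C D → Set
_≡F_ {C = C} {D = D} F G =
  Σ (∀ x → F₀ F x ≡ F₀ G x) λ p →
    ∀ {A B} (f : Hom[ C ] A B) → Category._≈_ D {F₀ G A} {F₀ G B} (cast D {f = F₀ F} {g = F₀ G} p {A} {B} (F₁ F f)) (F₁ G f)

IsIsoF : {O₁ O₂ : Set} {C : Category O₁} {D : Category O₂} → Functor C D → Set
IsIsoF {C = C} {D = D} T =
  Σ (Functor D C) λ U → ((U ∘F T) ≡F IdF C) × ((T ∘F U) ≡F IdF D)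

Graph : Set → Set₁
Graph V = V → V → Set

record Diagram {V : Set} (E : Graph V) {O : Set} (D : Category O) : Set where
  field
    vmap : V → O
    emap : ∀ {u v} → E u v → Hom[ D ] (vmap u) (vmap v)

open Diagram public

_≡D_ : {V : Set} {E : Graph V} {O : Set} {D : Category O} →
       Diagram E D → Diagram E D → Set
_≡D_ {E = E} {D = D} X Y =
  Σ (∀ x → vmap X x ≡ vmap Y x) λ p →
    ∀ {u v} (e : E u v) → Category._≈_ D {vmap Y u} {vmap Y v} (cast D {f = vmap X} {g = vmap Y} p {u} {v} (emap X e)) (emap Y e)

-- restriction of a functor C → D to a diagram of type E via a diagram in C
_⊙_ : {V : Set} {E : Graph V} {O₁ O₂ : Set} {C : Category O₁} {D : Category O₂} →
      Functor C D → Diagram E C → Diagram E D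
F ⊙ X = record { vmap = λ x → F₀ F (vmap X x) ; emap = λ e → F₁ F (emap X e) }

module PathCat {V : Set} (E : Graph V) where

  -- Path u v : paths with source u and range v, written in composition order
  -- (e ◂ p) means the path e p, i.e. s(e) = r(p).
  infixr 5 _◂_ _++_
  data Path : V → V → Set where
    []  : ∀ {u} → Path u u
    _◂_ : ∀ {u w v} → E w v → Path u w → Path u v

  _++_ : ∀ {u w v} → Path w v → Path u w → Path u v
  []      ++ q = q
  (e ◂ p) ++ q = e ◂ (p ++ q)

  ++-identityʳ : ∀ {u v} (p : Path u v) → p ++ [] ≡ p
  ++-identityʳ []      = refl
  ++-identityʳ (e ◂ p) = cong (e ◂_) (++-identityʳ p)

  ++-assoc : ∀ {a b c d} (p : Path c d) (q : Path b c) (r : Path a b) →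
             (p ++ q) ++ r ≡ p ++ (q ++ r)
  ++-assoc []      q r = refl
  ++-assoc (e ◂ p) q r = cong (e ◂_) (++-assoc p q r)

  Relations : Set₁
  Relations = ∀ {u v} → Path u v → Path u v → Set

  module Quotient (K : Relations) where

    data _~_ : ∀ {u v} → Path u v → Path u v → Set where
      base   : ∀ {u v} {p q : Path u v} → K p q → p ~ q
      ~refl  : ∀ {u v} {p : Path u v} → p ~ p
      ~sym   : ∀ {u v} {p q : Path u v} → p ~ q → q ~ p
      ~trans : ∀ {u v} {p q r : Path u v} → p ~ q → q ~ r → p ~ r
      ~cong  : ∀ {u w v} {p p' : Path w v} {q q' : Path u w} →
               p ~ p' → q ~ q' → (p ++ q) ~ (p' ++ q')

    ≡⇒~ : ∀ {u v} {p q : Path u v} → p ≡ q → p ~ q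
    ≡⇒~ refl = ~refl

    cat : Category V
    cat = record
      { Hom = Path
      ; _≈_ = _~_
      ; ≈-equiv = record { refl = ~refl ; sym = ~sym ; trans = ~trans }
      ; id = []
      ; _∘_ = _++_
      ; assoc = λ f g h → ≡⇒~ (++-assoc f g h)
      ; identityˡ = λ f → ~refl
      ; identityʳ = λ f → ≡⇒~ (++-identityʳ f)
      ; ∘-resp-≈ = ~cong
      }

    Δ : Diagram E cat
    Δ = record { vmap = λ x → x ; emap = λ e → e ◂ [] }

basis : ∀ {k} → Fin k → Vec ℕ k
basis j = tabulate λ i → if does (i Fin.≟ j) then 1 else 0

_⊕_ : ∀ {k} → Vec ℕ k → Vec ℕ k → Vec ℕ k
_⊕_ = zipWith _+_

0ᵛ : ∀ {k} → Vec ℕ k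
0ᵛ = tabulate λ _ → 0

record KGraph (k : ℕ) : Set₁ where
  infixr 9 _∘_
  field
    Obj       : Set
    Mor       : Obj → Obj → Set
    id        : ∀ {A} → Mor A A
    _∘_       : ∀ {A B C} → Mor B C → Mor A B → Mor A C
    assoc     : ∀ {A B C D} (f : Mor C D) (g : Mor B C) (h : Mor A B) →
                (f ∘ g) ∘ h ≡ f ∘ (g ∘ h)
    identityˡ : ∀ {A B} (f : Mor A B) → id ∘ f ≡ f
    identityʳ : ∀ {A B} (f : Mor A B) → f ∘ id ≡ f
    countable : Σ (Σ Obj (λ A → Σ Obj λ B → Mor A B) → ℕ) λ c → Injective _≡_ _≡_ c
    d         : ∀ {A B} → Mor A B → Vec ℕ k
    d-id      : ∀ {A} → d (id {A}) ≡ 0ᵛ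
    d-∘       : ∀ {A B C} (f : Mor B C) (g : Mor A B) → d (f ∘ g) ≡ d f ⊕ d g
    factorisation :
      ∀ {A C} (α : Mor A C) (n l : Vec ℕ k) → d α ≡ n ⊕ l →
      ∃! _≡_ λ (t : Σ Obj λ B → Mor B C × Mor A B) →
        let (B , β , γ) = t in (d β ≡ n) × (d γ ≡ l) × (β ∘ γ ≡ α)

module KG {k : ℕ} (Λ : KGraph k) where
  open KGraph Λ

  cat : Category Obj
  cat = record
    { Hom = Mor ; _≈_ = _≡_ ; ≈-equiv = isEquivalence ; id = id ; _∘_ = _∘_
    ; assoc = assoc ; identityˡ = identityˡ ; identityʳ = identityʳ
    ; ∘-resp-≈ = λ { refl refl → refl } }

  E : Graph Obj
  E u v = Σ (Mor u v) λ e → Σ (Fin k) λ j → d e ≡ basis j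

  dE : ∀ {u v} → E u v → Vec ℕ k
  dE e = d (proj₁ e)

  -- augmented graph E⁺ : inj₁ e is e, inj₂ e is the new edge e⁻¹
  E⁺ : Graph Obj
  E⁺ u v = E u v ⊎ E v u

  inv : ∀ {u v} → E⁺ u v → E⁺ v u
  inv (inj₁ e) = inj₂ e
  inv (inj₂ e) = inj₁ e

  open PathCat E⁺ public

  data CRel : Relations where
    cancel : ∀ {u v} (x : E⁺ u v) → CRel (inv x ◂ x ◂ []) []

  data SRel : Relations where
    square : ∀ {u w x v} (e : E w v) (f : E u w) (g : E x v) (h : E u x) →
             proj₁ e ∘ proj₁ f ≡ proj₁ g ∘ proj₁ h →
             dE g ≡ dE f → dE h ≡ dE e → ¬ (dE e ≡ dE f) →
             SRel (inj₁ e ◂ inj₁ f ◂ []) (inj₁ g ◂ inj₁ h ◂ [])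

  C∪S : Relations
  C∪S p q = CRel p q ⊎ SRel p q

  module Q = Quotient C∪S

  Δ|E : Diagram E Q.cat
  Δ|E = record { vmap = vmap Q.Δ ; emap = λ e → emap Q.Δ (inj₁ e) }

  incl : Diagram E cat
  incl = record { vmap = λ x → x ; emap = proj₁ }

  record IsFundamentalGroupoid (G : Category Obj) (i : Functor cat G) : Set₁ where
    field
      groupoid     : IsGroupoid G
      i-identity₀  : ∀ x → F₀ i x ≡ x
      i-inverts    : ∀ {A B} (a : Mor A B) → IsInvertible G (F₁ i a)
      universal    : ∀ {O : Set} (D : Category O) (F : Functor cat D) →
                     (∀ {A B} (a : Mor A B) → IsInvertible D (F₁ F a)) →
                     ∃! _≡F_ λ (F' : Functor G D) → (F' ∘F i) ≡F F

{-# OPTIONS --safe #-}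
-- By unique factorisation every morphism of Λ is the composite of a path of edges, and two
-- edge paths p, q with the same composite are related by commuting squares: squares move an
-- edge of the colour of the first edge of q to the front of p, after which unique factorisation
-- identifies the two first edges and the composites of the remaining paths.  Hence
-- α ↦ [edge path of α] is a functor Φ : Λ → P(E⁺)/(C ∪ S), which inverts everything by the
-- cancellation relations and so factors as T ∘ i.  Conversely e ↦ i e, e⁻¹ ↦ (i e)⁻¹ respects
-- C ∪ S and induces U.  Functors out of Λ or out of P(E⁺)/(C ∪ S) are determined by their
-- values on edges; this gives U ∘ T = id (via the universal property of i), T ∘ U = id and
-- the uniqueness of T.
module Submission where

open import Defs
open import Data.Nat using (ℕ; zero; suc; _+_; _≤_; s≤s; z≤n)
import Data.Nat.Properties as ℕ
open import Data.Fin using (Fin) renaming (zero to fzero; suc to fsuc)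
import Data.Fin as Fin
open import Data.Vec using (Vec; []; _∷_; lookup; sum)
import Data.Vec.Properties as Vec
open import Data.Product using (∃!; _×_; Σ; _,_; proj₁; proj₂)
open import Data.Product.Properties using (Σ-≡,≡←≡)
open import Data.Sum using (inj₁; inj₂)
open import Data.Bool using (if_then_else_)
open import Data.Empty using (⊥-elim)
open import Relation.Nullary using (¬_; yes; no)
open import Relation.Nullary.Decidable using (dec-true; dec-false)
open import Relation.Binary using (IsEquivalence; Setoid)
import Relation.Binary.Reasoning.Setoid as SetoidReasoning
open import Relation.Binary.PropositionalEquality
open import Axiom.UniquenessOfIdentityProofs using (UIP; module Decidable⇒UIP)

module CategoryLemmas {O : Set} (D : Category O) where
  open Category D
  module ≈ {A B} = IsEquivalence (≈-equiv {A} {B})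

  hom-setoid : O → O → Setoid _ _
  hom-setoid A B = record { Carrier = Hom A B ; _≈_ = _≈_ ; isEquivalence = ≈-equiv }

  module HomReasoning {A B : O} = SetoidReasoning (hom-setoid A B)

  inverse-unique : ∀ {A B} {f : Hom A B} {g h : Hom B A} → h ∘ f ≈ id → f ∘ g ≈ id → g ≈ h
  inverse-unique {f = f} {g} {h} hf≈id fg≈id = begin
    g             ≈⟨ ≈.sym (identityˡ g) ⟩
    id ∘ g        ≈⟨ ∘-resp-≈ (≈.sym hf≈id) ≈.refl ⟩
    (h ∘ f) ∘ g   ≈⟨ assoc h f g ⟩
    h ∘ (f ∘ g)   ≈⟨ ∘-resp-≈ ≈.refl fg≈id ⟩
    h ∘ id        ≈⟨ identityʳ h ⟩
    h             ∎
    where open HomReasoning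

  -- The morphism components of _≡F_ and _≡D_ unfold to this form.
  infix 4 _≈[_,_]_
  _≈[_,_]_ : ∀ {a a' b b'} → Hom a b → a ≡ a' → b ≡ b' → Hom a' b' → Set
  f ≈[ r , r' ] g = subst₂ Hom r r' f ≈ g

  ≈[]-id : ∀ {a a'} (r : a ≡ a') → id ≈[ r , r ] id
  ≈[]-id refl = ≈.refl

  ≈[]-∘ : ∀ {a a' b b' c c'} {r₁ : a ≡ a'} {r₂ : b ≡ b'} {r₃ : c ≡ c'}
          {f : Hom b c} {f' : Hom b' c'} {g : Hom a b} {g' : Hom a' b'} →
          f ≈[ r₂ , r₃ ] f' → g ≈[ r₁ , r₂ ] g' → f ∘ g ≈[ r₁ , r₃ ] f' ∘ g'
  ≈[]-∘ {r₁ = refl} {refl} {refl} = ∘-resp-≈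

  ≈[]-respˡ : ∀ {a a' b b'} {r : a ≡ a'} {r' : b ≡ b'} {f f' : Hom a b} {g : Hom a' b'} →
              f' ≈ f → f ≈[ r , r' ] g → f' ≈[ r , r' ] g
  ≈[]-respˡ {r = refl} {refl} = ≈.trans

  ≈[]-sym : ∀ {a a' b b'} {r : a ≡ a'} {r' : b ≡ b'} {f : Hom a b} {g : Hom a' b'} →
            f ≈[ r , r' ] g → g ≈[ sym r , sym r' ] f
  ≈[]-sym {r = refl} {refl} = ≈.sym

  ≈[]-trans : ∀ {a a' a'' b b' b''} {r : a ≡ a'} {r' : b ≡ b'} {s : a' ≡ a''} {s' : b' ≡ b''}
              {f : Hom a b} {g : Hom a' b'} {h : Hom a'' b''} →
              f ≈[ r , r' ] g → g ≈[ s , s' ] h → f ≈[ trans r s , trans r' s' ] h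
  ≈[]-trans {r = refl} {refl} {refl} {refl} = ≈.trans

F₁-resp-≈[] : ∀ {O₁ O₂} {C : Category O₁} {D : Category O₂} (F : Functor C D)
              {a a' b b'} {r : a ≡ a'} {r' : b ≡ b'} {f : Hom[ C ] a b} {g : Hom[ C ] a' b'} →
              CategoryLemmas._≈[_,_]_ C f r r' g →
              CategoryLemmas._≈[_,_]_ D (F₁ F f) (cong (F₀ F) r) (cong (F₀ F) r') (F₁ F g)
F₁-resp-≈[] F {r = refl} {refl} = F-resp-≈ F

module _ {O₁ O₂ : Set} {C : Category O₁} {D : Category O₂} where

  ≡F-sym : {F G : Functor C D} → F ≡F G → G ≡F F
  ≡F-sym (p , h) = (λ x → sym (p x)) , λ {A} {B} f →
    CategoryLemmas.≈[]-sym D {r = p A} {p B} (h f)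

  ≡F-trans : {F G H : Functor C D} → F ≡F G → G ≡F H → F ≡F H
  ≡F-trans (p , h) (q , h') = (λ x → trans (p x) (q x)) , λ {A} {B} f →
    CategoryLemmas.≈[]-trans D {r = p A} {p B} {q A} {q B} (h f) (h' f)

module Evaluation {V : Set} {E : Graph V} {O : Set} {D : Category O} (X : Diagram E D) where
  open PathCat E
  open Category D
  open CategoryLemmas D using (module ≈; module HomReasoning)

  ⟦_⟧ : ∀ {u v} → Path u v → Hom (vmap X u) (vmap X v)
  ⟦ [] ⟧    = id
  ⟦ e ◂ p ⟧ = emap X e ∘ ⟦ p ⟧

  ⟦⟧-++ : ∀ {u w v} (p : Path w v) (q : Path u w) → ⟦ p ++ q ⟧ ≈ ⟦ p ⟧ ∘ ⟦ q ⟧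
  ⟦⟧-++ []      q = ≈.sym (identityˡ ⟦ q ⟧)
  ⟦⟧-++ (e ◂ p) q = begin
    emap X e ∘ ⟦ p ++ q ⟧         ≈⟨ ∘-resp-≈ ≈.refl (⟦⟧-++ p q) ⟩
    emap X e ∘ (⟦ p ⟧ ∘ ⟦ q ⟧)    ≈⟨ ≈.sym (assoc (emap X e) ⟦ p ⟧ ⟦ q ⟧) ⟩
    (emap X e ∘ ⟦ p ⟧) ∘ ⟦ q ⟧    ∎
    where open HomReasoning

  module _ (K : Relations)
           (⟦⟧-resp-K : ∀ {u v} {p q : Path u v} → K p q → ⟦ p ⟧ ≈ ⟦ q ⟧) where
    open Quotient K

    ⟦⟧-resp-~ : ∀ {u v} {p q : Path u v} → p ~ q → ⟦ p ⟧ ≈ ⟦ q ⟧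
    ⟦⟧-resp-~ (base r)     = ⟦⟧-resp-K r
    ⟦⟧-resp-~ ~refl        = ≈.refl
    ⟦⟧-resp-~ (~sym r)     = ≈.sym (⟦⟧-resp-~ r)
    ⟦⟧-resp-~ (~trans r s) = ≈.trans (⟦⟧-resp-~ r) (⟦⟧-resp-~ s)
    ⟦⟧-resp-~ (~cong {p = p} {p'} {q} {q'} r s) = begin
      ⟦ p ++ q ⟧        ≈⟨ ⟦⟧-++ p q ⟩
      ⟦ p ⟧ ∘ ⟦ q ⟧     ≈⟨ ∘-resp-≈ (⟦⟧-resp-~ r) (⟦⟧-resp-~ s) ⟩
      ⟦ p' ⟧ ∘ ⟦ q' ⟧   ≈⟨ ≈.sym (⟦⟧-++ p' q') ⟩
      ⟦ p' ++ q' ⟧      ∎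
      where open HomReasoning

    induced : Functor cat D
    induced = record
      { F₀ = vmap X ; F₁ = ⟦_⟧ ; F-resp-≈ = ⟦⟧-resp-~
      ; identity = ≈.refl ; homomorphism = ⟦⟧-++ }

module _ {O₁ O₂ : Set} {C : Category O₁} {D : Category O₂} {E : Graph O₁}
         (gen : ∀ {u v} → E u v → Hom[ C ] u v) where
  open PathCat E
  open Category C using (_≈_)
  open CategoryLemmas D using (_≈[_,_]_; ≈[]-id; ≈[]-∘; ≈[]-respˡ) renaming (module ≈ to ≈D)
  open CategoryLemmas C using () renaming (module ≈ to ≈C)

  generated : Diagram E C
  generated = record { vmap = λ x → x ; emap = gen }

  open Evaluation generated

  ≡F-from-generators : (∀ {u v} (f : Hom[ C ] u v) → Σ (Path u v) λ p → ⟦ p ⟧ ≈ f) →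
                       {F G : Functor C D} → (F ⊙ generated) ≡D (G ⊙ generated) → F ≡F G
  ≡F-from-generators spans {F} {G} (q , on-gen) = q , λ f →
    let (p , ⟦p⟧≈f) = spans f in
    ≈[]-respˡ (F-resp-≈ F (≈C.sym ⟦p⟧≈f)) (≈D.trans (on-paths p) (F-resp-≈ G ⟦p⟧≈f))
    where
      on-paths : ∀ {u v} (p : Path u v) → F₁ F ⟦ p ⟧ ≈[ q u , q v ] F₁ G ⟦ p ⟧
      on-paths {u} [] = ≈[]-respˡ (identity F) (≈D.trans (≈[]-id (q u)) (≈D.sym (identity G)))
      on-paths (e ◂ p) = ≈[]-respˡ (homomorphism F (gen e) ⟦ p ⟧)
        (≈D.trans (≈[]-∘ (on-gen e) (on-paths p)) (≈D.sym (homomorphism G (gen e) ⟦ p ⟧)))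

lookup-basis-≡ : ∀ {n} (j : Fin n) → lookup (basis j) j ≡ 1
lookup-basis-≡ j =
  trans (Vec.lookup∘tabulate _ j) (cong (λ b → if b then 1 else 0) (dec-true (j Fin.≟ j) refl))

lookup-basis-≢ : ∀ {n} {i j : Fin n} → ¬ i ≡ j → lookup (basis j) i ≡ 0
lookup-basis-≢ {i = i} {j} i≢j =
  trans (Vec.lookup∘tabulate _ i) (cong (λ b → if b then 1 else 0) (dec-false (i Fin.≟ j) i≢j))

⊕-comm : ∀ {n} (u v : Vec ℕ n) → u ⊕ v ≡ v ⊕ u
⊕-comm = Vec.zipWith-comm ℕ.+-comm

⊕-identityˡ : ∀ {n} (v : Vec ℕ n) → 0ᵛ ⊕ v ≡ v
⊕-identityˡ []      = refl
⊕-identityˡ (x ∷ v) = cong (x ∷_) (⊕-identityˡ v)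

⊕-cancelˡ : ∀ {n} (u v w : Vec ℕ n) → u ⊕ v ≡ u ⊕ w → v ≡ w
⊕-cancelˡ []      []      []      _  = refl
⊕-cancelˡ (x ∷ u) (y ∷ v) (z ∷ w) eq =
  cong₂ _∷_ (ℕ.+-cancelˡ-≡ x y z (proj₁ (Vec.∷-injective eq)))
            (⊕-cancelˡ u v w (proj₂ (Vec.∷-injective eq)))

sum≡0⇒≡0ᵛ : ∀ {n} (v : Vec ℕ n) → sum v ≡ 0 → v ≡ 0ᵛ
sum≡0⇒≡0ᵛ []           _  = refl
sum≡0⇒≡0ᵛ (zero ∷ v)   eq = cong (0 ∷_) (sum≡0⇒≡0ᵛ v eq)

sum≡suc⇒basis⊕ : ∀ {n m} (v : Vec ℕ n) → sum v ≡ suc m →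
                 Σ (Fin n) λ j → Σ (Vec ℕ n) λ l → (v ≡ basis j ⊕ l) × (sum l ≡ m)
sum≡suc⇒basis⊕ (suc x ∷ v) eq =
  fzero , x ∷ v , cong (suc x ∷_) (sym (⊕-identityˡ v)) , ℕ.suc-injective eq
sum≡suc⇒basis⊕ (zero ∷ v)  eq =
  let (j , l , v≡ , sl) = sum≡suc⇒basis⊕ v eq in fsuc j , 0 ∷ l , cong (0 ∷_) v≡ , sl

≡-irrelevant-Vecℕ : ∀ {n} → UIP (Vec ℕ n)
≡-irrelevant-Vecℕ = Decidable⇒UIP.≡-irrelevant (Vec.≡-dec ℕ._≟_)

module AugmentedPaths {k : ℕ} (Λ : KGraph k) where
  open KG Λ
  open Q using (_~_; base; ~refl; ~cong; ≡⇒~)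
  open CategoryLemmas Q.cat using (module HomReasoning)

  ◂-cong : ∀ {u w v} (x : E⁺ w v) {p q : Path u w} → p ~ q → (x ◂ p) ~ (x ◂ q)
  ◂-cong x = ~cong (~refl {p = x ◂ []})

  reverse : ∀ {u v} → Path u v → Path v u
  reverse []      = []
  reverse (x ◂ p) = reverse p ++ (inv x ◂ [])

  inv-cancel : ∀ {u v} (x : E⁺ u v) → (x ◂ inv x ◂ []) ~ []
  inv-cancel (inj₁ e) = base (inj₁ (cancel (inj₂ e)))
  inv-cancel (inj₂ e) = base (inj₁ (cancel (inj₁ e)))

  reverse-inverseˡ : ∀ {u v} (p : Path u v) → (reverse p ++ p) ~ []
  reverse-inverseˡ []      = ~refl
  reverse-inverseˡ (x ◂ p) = begin
    (reverse p ++ (inv x ◂ [])) ++ (x ◂ p)   ≡⟨ ++-assoc (reverse p) (inv x ◂ []) (x ◂ p) ⟩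
    reverse p ++ (inv x ◂ x ◂ p)             ≈⟨ ~cong (~refl {p = reverse p})
                                                       (~cong (base (inj₁ (cancel x))) (~refl {p = p})) ⟩
    reverse p ++ p                           ≈⟨ reverse-inverseˡ p ⟩
    []                                       ∎
    where open HomReasoning

  reverse-inverseʳ : ∀ {u v} (p : Path u v) → (p ++ reverse p) ~ []
  reverse-inverseʳ []      = ~refl
  reverse-inverseʳ (x ◂ p) = begin
    x ◂ (p ++ (reverse p ++ (inv x ◂ [])))   ≡⟨ cong (x ◂_) (sym (++-assoc p (reverse p) (inv x ◂ []))) ⟩
    x ◂ ((p ++ reverse p) ++ (inv x ◂ []))   ≈⟨ ◂-cong x (~cong (reverse-inverseʳ p) ~refl) ⟩
    x ◂ inv x ◂ []                           ≈⟨ inv-cancel x ⟩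
    []                                       ∎
    where open HomReasoning

  Q-groupoid : IsGroupoid Q.cat
  Q-groupoid p = reverse p , reverse-inverseˡ p , reverse-inverseʳ p

  open Evaluation Q.Δ using () renaming (⟦_⟧ to ⟦_⟧Δ)

  ⟦⟧Δ-id : ∀ {u v} (p : Path u v) → ⟦ p ⟧Δ ≡ p
  ⟦⟧Δ-id []      = refl
  ⟦⟧Δ-id (x ◂ p) = cong (x ◂_) (⟦⟧Δ-id p)

  Q-generated : ∀ {u v} (p : Path u v) → Σ (Path u v) λ q → ⟦ q ⟧Δ ~ p
  Q-generated p = p , ≡⇒~ (⟦⟧Δ-id p)

module Skeleton {k : ℕ} (Λ : KGraph k) where
  open KGraph Λ
  open KG Λ
  open AugmentedPaths Λ using (◂-cong)
  open Q using (_~_; base; ~refl; ~trans; ~cong)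
  open PathCat E using () renaming (Path to EPath; [] to []ₑ; _◂_ to _◂ₑ_; _++_ to _++ₑ_)
  open Evaluation incl using () renaming (⟦_⟧ to ⟦_⟧Λ; ⟦⟧-++ to ⟦⟧Λ-++)
  open Evaluation Δ|E using () renaming (⟦_⟧ to ⟦_⟧Q; ⟦⟧-++ to ⟦⟧Q-++)

  Factorisation : Obj → Obj → Set
  Factorisation A C = Σ Obj λ B → Mor B C × Mor A B

  factorisation-unique : ∀ {A C w w'} (g : Mor w C) (f : Mor w' C) (β : Mor A w) (γ : Mor A w') →
    d g ≡ d f → g ∘ β ≡ f ∘ γ → _≡_ {A = Factorisation A C} (w , g , β) (w' , f , γ)
  factorisation-unique g f β γ dg≡df gβ≡fγ =
    let (_ , _ , unique) = factorisation (g ∘ β) (d g) (d β) (d-∘ g β)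
    in trans (sym (unique (refl , refl , refl))) (unique (sym dg≡df , dγ≡dβ , sym gβ≡fγ))
    where
      dγ≡dβ : d γ ≡ d β
      dγ≡dβ = ⊕-cancelˡ (d g) (d γ) (d β)
        (trans (cong (_⊕ d γ) dg≡df) (trans (sym (d-∘ f γ)) (trans (cong d (sym gβ≡fγ)) (d-∘ g β))))

  degree-zero⇒identity : ∀ {A C} (α : Mor A C) → d α ≡ 0ᵛ →
                         Σ (A ≡ C) λ r → subst (Mor A) r id ≡ α
  degree-zero⇒identity α dα≡0
    with refl , idα≡αid ← Σ-≡,≡←≡ (factorisation-unique id α α id (trans d-id (sym dα≡0))
                                                       (trans (identityˡ α) (sym (identityʳ α))))
    = refl , cong proj₁ idα≡αid

  path-of-size : ∀ m {A C} (α : Mor A C) → sum (d α) ≡ m → Σ (EPath A C) λ p → ⟦ p ⟧Λ ≡ α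
  path-of-size zero α size≡0
    with refl , id≡α ← degree-zero⇒identity α (sum≡0⇒≡0ᵛ (d α) size≡0)
    = []ₑ , id≡α
  path-of-size (suc m) α size≡1+m =
    let (j , l , dα≡ , size-l) = sum≡suc⇒basis⊕ (d α) size≡1+m
        (_ , β , γ) , (dβ , dγ , βγ≡α) , _ = factorisation α (basis j) l dα≡
        (p , p≡γ) = path-of-size m γ (trans (cong sum dγ) size-l)
    in (β , j , dβ) ◂ₑ p , trans (cong (β ∘_) p≡γ) βγ≡α

  path-of : ∀ {A C} (α : Mor A C) → Σ (EPath A C) λ p → ⟦ p ⟧Λ ≡ α
  path-of α = path-of-size (sum (d α)) α refl

  ≡F-from-skeleton : ∀ {O} {D : Category O} {F G : Functor cat D} → (F ⊙ incl) ≡D (G ⊙ incl) → F ≡F G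
  ≡F-from-skeleton {D = D} {F} {G} = ≡F-from-generators {D = D} proj₁ path-of {F} {G}

  count : ∀ {A B} → Mor A B → Fin k → ℕ
  count α j = lookup (d α) j

  count-id : ∀ {A} j → ¬ 1 ≤ count (id {A}) j
  count-id j 1≤ with () ← subst (1 ≤_) (trans (cong (λ v → lookup v j) d-id) (Vec.lookup∘tabulate _ j)) 1≤

  count-edge∘ : ∀ {A B C} {e : Mor B C} {j₀} → d e ≡ basis j₀ → (g : Mor A B) (j : Fin k) →
                count (e ∘ g) j ≡ lookup (basis j₀) j + count g j
  count-edge∘ {e = e} de g j =
    trans (cong (λ v → lookup v j) (d-∘ e g))
          (trans (Vec.lookup-zipWith _+_ j (d e) (d g)) (cong (λ v → lookup v j + count g j) de))

  edge∘-has-colour : ∀ {A B C} {e : Mor B C} {j} → d e ≡ basis j → (g : Mor A B) → 1 ≤ count (e ∘ g) j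
  edge∘-has-colour {j = j} de g =
    subst (1 ≤_) (sym (trans (count-edge∘ de g j) (cong (_+ count g j) (lookup-basis-≡ j)))) (s≤s z≤n)

  swap-colours : ∀ {u w v} {i j} (e : Mor w v) (f : Mor u w) (de : d e ≡ basis i) (df : d f ≡ basis j) →
    ¬ i ≡ j →
    Σ Obj λ x → Σ (Mor x v) λ g → Σ (Mor u x) λ h →
    Σ (d g ≡ basis j) λ dg → Σ (d h ≡ basis i) λ dh →
      (e ∘ f ≡ g ∘ h) ×
      ((inj₁ (e , i , de) ◂ inj₁ (f , j , df) ◂ []) ~ (inj₁ (g , j , dg) ◂ inj₁ (h , i , dh) ◂ []))
  swap-colours {i = i} {j} e f de df i≢j =
    let (x , g , h) , (dg , dh , gh≡ef) , _ = factorisation (e ∘ f) (basis j) (basis i) d[ef]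
    in x , g , h , dg , dh , sym gh≡ef
     , base (inj₂ (square _ _ _ _ (sym gh≡ef) (trans dg (sym df)) (trans dh (sym de)) de≢df))
    where
      d[ef] : d (e ∘ f) ≡ basis j ⊕ basis i
      d[ef] = trans (d-∘ e f) (trans (cong₂ _⊕_ de df) (⊕-comm (basis i) (basis j)))
      de≢df : ¬ d e ≡ d f
      de≢df de≡df with () ← trans (sym (lookup-basis-≡ i))
        (trans (cong (λ v → lookup v i) (trans (sym de) (trans de≡df df))) (lookup-basis-≢ i≢j))

  pull-colour : ∀ {A C} (p : EPath A C) (j : Fin k) → 1 ≤ count ⟦ p ⟧Λ j →
    Σ Obj λ w → Σ (Mor w C) λ g → Σ (d g ≡ basis j) λ dg → Σ (EPath A w) λ p' →
      (⟦ p ⟧Q ~ ⟦ (g , j , dg) ◂ₑ p' ⟧Q) × (⟦ p ⟧Λ ≡ ⟦ (g , j , dg) ◂ₑ p' ⟧Λ)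
  pull-colour []ₑ j 1≤ = ⊥-elim (count-id j 1≤)
  pull-colour ((e , j₀ , de) ◂ₑ p) j 1≤ with j₀ Fin.≟ j
  ... | yes refl = _ , e , de , p , ~refl , refl
  ... | no j₀≢j =
    let (w , f , df , p' , p~fp' , p≡fp') = pull-colour p j (subst (1 ≤_) count-past-e 1≤)
        (x , g , h , dg , dh , ef≡gh , ef~gh) = swap-colours e f de df j₀≢j
    in x , g , dg , (h , j₀ , dh) ◂ₑ p'
     , ~trans (◂-cong _ p~fp') (~cong ef~gh (~refl {p = ⟦ p' ⟧Q}))
     , (begin
         e ∘ ⟦ p ⟧Λ              ≡⟨ cong (e ∘_) p≡fp' ⟩
         e ∘ (f ∘ ⟦ p' ⟧Λ)       ≡⟨ sym (assoc e f _) ⟩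
         (e ∘ f) ∘ ⟦ p' ⟧Λ       ≡⟨ cong (_∘ ⟦ p' ⟧Λ) ef≡gh ⟩
         (g ∘ h) ∘ ⟦ p' ⟧Λ       ≡⟨ assoc g h _ ⟩
         g ∘ (h ∘ ⟦ p' ⟧Λ)       ∎)
    where
      open ≡-Reasoning
      count-past-e : count (e ∘ ⟦ p ⟧Λ) j ≡ count ⟦ p ⟧Λ j
      count-past-e = trans (count-edge∘ de ⟦ p ⟧Λ j)
                           (cong (_+ count ⟦ p ⟧Λ j) (lookup-basis-≢ (λ j≡j₀ → j₀≢j (sym j≡j₀))))

  coherence : ∀ {A C} (p q : EPath A C) → ⟦ p ⟧Λ ≡ ⟦ q ⟧Λ → ⟦ p ⟧Q ~ ⟦ q ⟧Q
  coherence []ₑ []ₑ _ = ~refl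
  coherence ((e , j , de) ◂ₑ p) []ₑ ep≡id =
    ⊥-elim (count-id j (subst (λ α → 1 ≤ count α j) ep≡id (edge∘-has-colour de _)))
  coherence p ((f , j , df) ◂ₑ q) p≡fq
    with w , g , dg , p' , p~gp' , p≡gp' ←
           pull-colour p j (subst (λ α → 1 ≤ count α j) (sym p≡fq) (edge∘-has-colour df _))
    with refl , gp'≡fq ←
           Σ-≡,≡←≡ (factorisation-unique g f _ _ (trans dg (sym df)) (trans (sym p≡gp') p≡fq))
    with refl ← cong proj₁ gp'≡fq
    with refl ← ≡-irrelevant-Vecℕ dg df
    = ~trans p~gp' (◂-cong _ (coherence p' q (cong proj₂ gp'≡fq)))

  Φ : Functor cat Q.cat
  Φ = record
    { F₀ = λ x → x
    ; F₁ = λ α → ⟦ proj₁ (path-of α) ⟧Q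
    ; F-resp-≈ = λ { refl → ~refl }
    ; identity = coherence (proj₁ (path-of id)) []ₑ (proj₂ (path-of id))
    ; homomorphism = λ f g →
        let (p , p≡f) = path-of f
            (q , q≡g) = path-of g
            (r , r≡fg) = path-of (f ∘ g)
        in ~trans (coherence r (p ++ₑ q) (trans r≡fg (sym (trans (⟦⟧Λ-++ p q) (cong₂ _∘_ p≡f q≡g)))))
                  (⟦⟧Q-++ p q)
    }

  Φ-edge : ∀ {u v} (e : E u v) → F₁ Φ (proj₁ e) ~ (inj₁ e ◂ [])
  Φ-edge e = let (p , p≡e) = path-of (proj₁ e) in coherence p (e ◂ₑ []ₑ) (trans p≡e (sym (identityʳ _)))

module FundamentalGroupoid {k : ℕ} (Λ : KGraph k) (G : Category (KGraph.Obj Λ))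
                           (i : Functor (KG.cat Λ) G) (isFG : KG.IsFundamentalGroupoid Λ G i) where
  open KGraph Λ using (_∘_)
  open KG Λ
  open AugmentedPaths Λ using (Q-groupoid; Q-generated)
  open Skeleton Λ using (Φ; Φ-edge; ≡F-from-skeleton)
  open IsFundamentalGroupoid isFG
  open Q using (_~_; base; ~refl; ~sym; ~trans; ~cong)
  module G = Category G
  open CategoryLemmas G using () renaming (module ≈ to ≈G; module HomReasoning to GReasoning)
  open CategoryLemmas Q.cat using (_≈[_,_]_; inverse-unique; ≈[]-id; ≈[]-∘; ≈[]-respˡ)

  T-universal : ∃! _≡F_ λ (T : Functor G Q.cat) → (T ∘F i) ≡F Φ
  T-universal = universal Q.cat Φ (λ α → Q-groupoid (F₁ Φ α))

  T : Functor G Q.cat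
  T = proj₁ T-universal

  T∘i≡Φ : (T ∘F i) ≡F Φ
  T∘i≡Φ = proj₁ (proj₂ T-universal)

  T-on-objects : ∀ x → F₀ T (F₀ i x) ≡ x
  T-on-objects = proj₁ T∘i≡Φ

  T-on-edges : (T ⊙ (i ⊙ incl)) ≡D Δ|E
  T-on-edges = T-on-objects , λ e → ~trans (proj₂ T∘i≡Φ (proj₁ e)) (Φ-edge e)

  T-unique : ∀ {Y} → (Y ⊙ (i ⊙ incl)) ≡D Δ|E → T ≡F Y
  T-unique {Y} (q , Y-on-edges) = proj₂ (proj₂ T-universal) {Y}
    (≡F-from-skeleton {F = Y ∘F i} {Φ} (q , λ e → ~trans (Y-on-edges e) (~sym (Φ-edge e))))

  i⁺-edge : ∀ {u v} → E⁺ u v → G.Hom (F₀ i u) (F₀ i v)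
  i⁺-edge (inj₁ e) = F₁ i (proj₁ e)
  i⁺-edge (inj₂ e) = proj₁ (i-inverts (proj₁ e))

  i⁺ : Diagram E⁺ G
  i⁺ = record { vmap = F₀ i ; emap = i⁺-edge }

  open Evaluation i⁺ using (⟦_⟧; induced)

  i⁺-respects : ∀ {u v} {p q : Path u v} → C∪S p q → ⟦ p ⟧ G.≈ ⟦ q ⟧
  i⁺-respects (inj₁ (cancel (inj₁ e))) =
    ≈G.trans (G.∘-resp-≈ ≈G.refl (G.identityʳ _)) (proj₁ (proj₂ (i-inverts (proj₁ e))))
  i⁺-respects (inj₁ (cancel (inj₂ e))) =
    ≈G.trans (G.∘-resp-≈ ≈G.refl (G.identityʳ _)) (proj₂ (proj₂ (i-inverts (proj₁ e))))
  i⁺-respects (inj₂ (square (e , _) (f , _) (g , _) (h , _) ef≡gh _ _ _)) = begin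
    F₁ i e G.∘ (F₁ i f G.∘ G.id)   ≈⟨ G.∘-resp-≈ ≈G.refl (G.identityʳ _) ⟩
    F₁ i e G.∘ F₁ i f              ≈⟨ ≈G.sym (homomorphism i e f) ⟩
    F₁ i (e ∘ f)                   ≡⟨ cong (F₁ i) ef≡gh ⟩
    F₁ i (g ∘ h)                   ≈⟨ homomorphism i g h ⟩
    F₁ i g G.∘ F₁ i h              ≈⟨ G.∘-resp-≈ ≈G.refl (≈G.sym (G.identityʳ _)) ⟩
    F₁ i g G.∘ (F₁ i h G.∘ G.id)   ∎
    where open GReasoning

  U : Functor Q.cat G
  U = induced C∪S i⁺-respects

  -- U ∘ T and the identity both factor i through i.
  U∘T≡Id : (U ∘F T) ≡F IdF G
  U∘T≡Id = ≡F-trans {F = U ∘F T} {X} {IdF G} (≡F-sym {F = X} {U ∘F T} (unique {U ∘F T} U∘T∘i≡i))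
                                             (unique {IdF G} ((λ _ → refl) , λ _ → ≈G.refl))
    where
      X = proj₁ (universal G i i-inverts)
      unique = proj₂ (proj₂ (universal G i i-inverts))
      U∘T∘i≡i : ((U ∘F T) ∘F i) ≡F i
      U∘T∘i≡i = ≡F-from-skeleton {F = (U ∘F T) ∘F i} {i}
        ( (λ x → cong (F₀ i) (T-on-objects x))
        , λ {u} {v} e → ≈G.trans (F₁-resp-≈[] U {r = T-on-objects u} {T-on-objects v} (proj₂ T-on-edges e))
                                 (G.identityʳ _))

  -- T (i e)⁻¹ is a right inverse of e, and e⁻¹ is a left inverse of e.
  T-on-E⁺ : ∀ {u v} (x : E⁺ u v) → F₁ T (i⁺-edge x) ≈[ T-on-objects u , T-on-objects v ] (x ◂ [])
  T-on-E⁺ (inj₁ e) = proj₂ T-on-edges e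
  T-on-E⁺ {u} {v} (inj₂ e) = inverse-unique (base (inj₁ (cancel (inj₁ e)))) e∘T[b]≈id
    where
      P = T-on-objects
      a = F₁ i (proj₁ e)
      b = proj₁ (i-inverts (proj₁ e))
      Ta∘Tb≈id : (F₁ T a ++ F₁ T b) ≈[ P u , P u ] []
      Ta∘Tb≈id = ≈[]-respˡ (~trans (~sym (homomorphism T a b))
                                   (~trans (F-resp-≈ T (proj₂ (proj₂ (i-inverts (proj₁ e))))) (identity T)))
                           (≈[]-id (P u))
      e∘T[b]≈id : (inj₁ e ◂ subst₂ Path (P u) (P v) (F₁ T b)) ~ []
      e∘T[b]≈id = ~trans (~cong (~sym (T-on-E⁺ (inj₁ e))) ~refl)
                         (~trans (~sym (≈[]-∘ {r₁ = P u} {P v} {P u} ~refl ~refl)) Ta∘Tb≈id)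

  T∘U≡Id : (T ∘F U) ≡F IdF Q.cat
  T∘U≡Id = ≡F-from-generators (λ x → x ◂ []) Q-generated {T ∘F U} {IdF Q.cat}
    (T-on-objects , λ x → ≈[]-respˡ (F-resp-≈ T (G.identityʳ _)) (T-on-E⁺ x))

theorem5p5 : (k : ℕ) (Λ : KGraph k) (G : Category (KGraph.Obj Λ))
             (i : Functor (KG.cat Λ) G) →
             KG.IsFundamentalGroupoid Λ G i →
             ∃! _≡F_ (λ (T : Functor G (KG.Q.cat Λ)) →
               IsIsoF T × ((T ⊙ (i ⊙ KG.incl Λ)) ≡D KG.Δ|E Λ))
theorem5p5 k Λ G i isFG =
  T , ((U , U∘T≡Id , T∘U≡Id) , T-on-edges) , λ {Y} (_ , Y-on-edges) → T-unique {Y} Y-on-edges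
  where open FundamentalGroupoid Λ G i isFG
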